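{- For every marked perfect matching $\mathfrak{m}$ with respect to $(n_1,\dots,n_k)$, $\mathrm{bwex}(\Phi(\mathfrak{m}))=\mathrm{bwex}(\mathfrak{m})$.
   Context: Fix positive integers $n_1,\dots,n_k$ and $N=n_1+\dots+n_k$. Let $\pi$ be a permutation of $[N]$, viewed as a perfect matching with edges $e_i=(i,\overline{\pi(i)})$. An edge $e_i$ is homogeneous if $n_1+\dots+n_{r-1}+1\le i,\pi(i)\le n_1+\dots+n_r$ for some $r\in[k]$, inhomogeneous otherwise; $E^H(\pi)$ is the set of homogeneous edges. A marked perfect matching is a pair $\mathfrak{m}=(\pi,S)$ with $S$ a set of edges of $\pi$ containing all inhomogeneous edges (edges in $S$ are marked). $\mathrm{bind}^U_{\mathfrak{m}}(i)$ is $1$ plus the number of $u<i$ with $e_u\in S$; $\mathrm{bind}^L_{\mathfrak{m}}(j)$ is $1$ plus the number of $v<j$ such that the edge with lower endpoint $\bar v$ is in $S$; $\mathrm{bdiff}_{\mathfrak{m}}(e_i)=\mathrm{bind}^L_{\mathfrak{m}}(\pi(i))-\mathrm{bind}^U_{\mathfrak{m}}(i)$. $\mathrm{bwex}(\mathfrak{m})$ is the number of edges $e$ of $\pi$ with $\mathrm{bdiff}_{\mathfrak{m}}(e)\ge0$. Two edges $e_a,e_b$ cross if $(a-b)(\pi(a)-\pi(b))<0$; $e_j$ crosses $e_i$ from the left (equivalently $e_i$ crosses $e_j$ from the right) if $j<i$ and $\pi(j)>\pi(i)$. A homogeneous edge $e$ is convertible in $\mathfrak{m}$ if: when $e\notin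 S$, every edge $e'$ crossing $e$ either crosses $e$ from the left with $\mathrm{bdiff}_{\mathfrak{m}}(e')\ge0$ or crosses $e$ from the right with $\mathrm{bdiff}_{\mathfrak{m}}(e')\le-1$; when $e\in S$, every edge $e'$ crossing $e$ either crosses $e$ from the left with $\mathrm{bdiff}_{\mathfrak{m}}(e')>0$ or crosses $e$ from the right with $\mathrm{bdiff}_{\mathfrak{m}}(e')<-1$. $\triangle$ denotes symmetric difference. The map $\Phi$ on marked perfect matchings is defined as follows. Case 0: if $E^H(\pi)=\emptyset$, $\Phi(\mathfrak{m})=\mathfrak{m}$. Case 1: if $E^H(\pi)\ne\emptyset$ and $\mathrm{bdiff}_{\mathfrak{m}}(e)\ge0$ for all $e\in E^H(\pi)$, then $\Phi(\mathfrak{m})=(\pi,S\triangle\{e_i\})$ where $\pi(i)=\min\{\pi(j):e_j\in E^H(\pi)\}$. Case 2: otherwise let $i=\min\{j: e_j\in E^H(\pi),\ \mathrm{bdiff}_{\mathfrak{m}}(e_j)<0\}$; (a) if $e_i$ is convertible in $\mathfrak{m}$, $\Phi(\mathfrak{m})=(\pi,S\triangle\{e_i\})$; (b) if not, $\Phi(\mathfrak{m})=(\pi,S\triangle\{e_{i'}\})$ with $i'=\max\{j<i: e_j\in E^H(\pi),\ \mathrm{bdiff}_{\mathfrak{m}}(e_j)=0,\ e_j\text{ crosses } e_i\}$ (this set is nonempty in case (b), so $\Phi$ is well defined). -}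

module Defs where

open import Data.Nat.Base using (ℕ; zero; suc; _+_; _∸_; _<ᵇ_; _≡ᵇ_)
open import Data.Integer.Base using (ℤ; +_; -[1+_]; _-_; _≤ᵇ_; 0ℤ; 1ℤ; -1ℤ)
open import Data.Integer.Properties using () renaming (_≟_ to _≟ℤ_)
open import Data.Bool.Base using (Bool; true; false; _∧_; _∨_; not; if_then_else_)
open import Data.Maybe.Base using (Maybe; just; nothing; maybe′)
open import Data.Fin.Base using (Fin; zero; suc; toℕ)
open import Data.Fin.Subset using (Subset)
open import Data.Vec.Base using (lookup; updateAt)
open import Data.Fin.Permutation using (Permutation′; _⟨$⟩ʳ_; _⟨$⟩ˡ_)
open import Data.List.Base using (List; []; _∷_)
open import Data.Nat.ListAction using (sum)
open import Data.Product.Base using (_×_; _,_; proj₂)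
open import Relation.Nullary.Decidable.Core using (does)
open import Relation.Binary.PropositionalEquality using (_≡_)

-- Positions 1..N of the paper are represented by Fin N (0-based):
-- paper index i corresponds to the element of Fin N with toℕ = i - 1.
-- The composition (n₁,…,n_k) is a list ns; N = sum ns.
-- A permutation π of [N] is an element of Permutation′ N; edge e_i is
-- (i , π(i)‾), so it is indexed by its upper endpoint i : Fin N.
-- The marked set S of edges is a Subset N of upper endpoints
-- (e_i ∈ S iff lookup S i ≡ true).

countF : ∀ {n} → (Fin n → Bool) → ℕ
countF {zero}  f = 0
countF {suc n} f = (if f zero then 1 else 0) + countF (λ x → f (suc x))

allF : ∀ {n} → (Fin n → Bool) → Bool
allF {zero}  f = true
allF {suc n} f = f zero ∧ allF (λ x → f (suc x))

firstF : ∀ {n} → (Fin n → Bool) → Maybe (Fin n)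
firstF {zero}  f = nothing
firstF {suc n} f = if f zero then just zero
                   else maybe′ (λ x → just (suc x)) nothing (firstF (λ x → f (suc x)))

lastF : ∀ {n} → (Fin n → Bool) → Maybe (Fin n)
lastF {zero}  f = nothing
lastF {suc n} f = maybe′ (λ x → just (suc x))
                        (if f zero then just zero else nothing)
                        (lastF (λ x → f (suc x)))

-- index (0-based) of the block containing the 0-based position x:
-- block ns x = r - 1  iff  n₁+…+n_{r-1} ≤ x < n₁+…+n_r
block : List ℕ → ℕ → ℕ
block []       x = 0
block (n ∷ ns) x = if x <ᵇ n then 0 else suc (block ns (x ∸ n))

module _ (ns : List ℕ) (π : Permutation′ (sum ns)) where

  N : ℕ
  N = sum ns

  _<F_ : Fin N → Fin N → Bool
  a <F b = toℕ a <ᵇ toℕ b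

  homogeneous : Fin N → Bool
  homogeneous i = block ns (toℕ i) ≡ᵇ block ns (toℕ (π ⟨$⟩ʳ i))

  crossesFromLeft : Fin N → Fin N → Bool
  crossesFromLeft j i = (j <F i) ∧ ((π ⟨$⟩ʳ i) <F (π ⟨$⟩ʳ j))

  crossesFromRight : Fin N → Fin N → Bool
  crossesFromRight j i = crossesFromLeft i j

  cross : Fin N → Fin N → Bool
  cross a b = crossesFromLeft a b ∨ crossesFromRight a b

  module _ (S : Subset N) where

    marked : Fin N → Bool
    marked i = lookup S i

    bindU : Fin N → ℕ
    bindU i = suc (countF (λ u → (u <F i) ∧ marked u))

    bindL : Fin N → ℕ
    bindL j = suc (countF (λ v → (v <F j) ∧ marked (π ⟨$⟩ˡ v)))

    bdiff : Fin N → ℤ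
    bdiff i = + bindL (π ⟨$⟩ʳ i) - + bindU i

    bwex : ℕ
    bwex = countF (λ i → 0ℤ ≤ᵇ bdiff i)

    convertible : Fin N → Bool
    convertible i =
      if marked i
      then allF (λ j → not (cross j i)
                       ∨ (crossesFromLeft j i ∧ (1ℤ ≤ᵇ bdiff j))
                       ∨ (crossesFromRight j i ∧ (bdiff j ≤ᵇ -[1+ 1 ])))
      else allF (λ j → not (cross j i)
                       ∨ (crossesFromLeft j i ∧ (0ℤ ≤ᵇ bdiff j))
                       ∨ (crossesFromRight j i ∧ (bdiff j ≤ᵇ -1ℤ)))

    toggle : Fin N → Subset N
    toggle i = updateAt S i not

    case2 : Fin N → Subset N
    case2 i =
      if convertible i
      then toggle i                                             -- case 2(a)
      else maybe′ toggle S                                       -- case 2(b)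
             (lastF (λ j → (j <F i) ∧ homogeneous j
                           ∧ does (bdiff j ≟ℤ 0ℤ) ∧ cross j i))
      -- (the paper shows the set in 2(b) is nonempty; the fallback S is never used)

    ΦS : Subset N
    ΦS = maybe′
           (λ v → maybe′ case2                                   -- case 2
                    (toggle (π ⟨$⟩ˡ v))                         -- case 1
                    (firstF (λ j → homogeneous j ∧ (bdiff j ≤ᵇ -1ℤ))))
           S                                                    -- case 0
           (firstF (λ v → homogeneous (π ⟨$⟩ˡ v)))
      -- v ranges over lower endpoints; the first v whose edge is homogeneous
      -- is min{π(j) : e_j ∈ E^H(π)}, and its edge is e_{π⁻¹(v)}.

  IsMarked : Subset N → Set
  IsMarked S = ∀ i → homogeneous i ≡ false → lookup S i ≡ true

Φ : (ns : List ℕ) → Permutation′ (sum ns) × Subset (sum ns)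
  → Permutation′ (sum ns) × Subset (sum ns)
Φ ns (π , S) = π , ΦS ns π S

bwexM : (ns : List ℕ) → Permutation′ (sum ns) × Subset (sum ns) → ℕ
bwexM ns (π , S) = bwex ns π S

-- Toggling the mark of an edge e_t changes bind^U(i) by one exactly when t < i and
-- bind^L(π(i)) by one exactly when π(t) < π(i), both in the same direction.  So bdiff
-- moves only on the edges crossing e_t, by one step, and bwex is preserved as long as no
-- crossing edge sits right next to the threshold 0 on the side it moves towards
-- (Toggleable).  In case 2(a) this is convertibility itself.  In cases 1 and 2(b) it
-- follows from the extremal choice of the toggled edge, together with the fact that
-- unmarked edges are homogeneous, so that bind^U and bind^L agree at every block
-- boundary n₁ + ⋯ + n_r.

module Submission where

open import Defs
open import Data.Nat.Base using (ℕ; zero; suc; _+_; _∸_; _≤_; _<_; _<ᵇ_; z≤n; s≤s; z<s; s<s; s≤s⁻¹; s<s⁻¹)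
open import Data.Nat.Properties
  using (module ≤-Reasoning; _<?_; ≤-refl; ≤-trans; <-trans; ≤-reflexive; ≤-antisym; <⇒≤; <⇒≱;
        <⇒≢; ≮⇒≥; ≤∧≢⇒<; <-asym; <-irrefl; <-cmp; <-≤-trans; ≤-<-trans; n<1+n; m≤m+n; m≤n+m;
        m<m+n; m+n≮m; m+1+n≢m; m≢1+m+n; +-identityʳ; +-assoc; +-comm; +-suc; +-mono-≤;
        +-monoˡ-≤; +-monoʳ-≤; +-monoʳ-<; +-cancelʳ-≤; +-cancelʳ-<; +-cancelʳ-≡; +-cancelˡ-<;
        m+[n∸m]≡n; <ᵇ⇒<; <⇒<ᵇ; <ᵇ-reflects-<; ≡ᵇ⇒≡; ≡⇒≡ᵇ; +-0-commutativeMonoid;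
        +-commutativeSemigroup)
import Data.Integer.Base as ℤ
open import Data.Integer.Base using (_⊖_)
open import Data.Integer.Properties using ([1+m]⊖[1+n]≡m⊖n) renaming (_≟_ to _≟ℤ_)
open import Data.Bool.Base using (Bool; true; false; _∧_; _∨_; not; if_then_else_; T)
open import Data.Bool.Properties using (T-≡; T-∧; T-∨; ∧-zeroʳ)
open import Data.Fin.Base using (Fin; zero; suc; toℕ)
import Data.Fin.Properties as Finₚ
open import Data.Fin.Permutation using (Permutation′; _⟨$⟩ʳ_; _⟨$⟩ˡ_; inverseˡ; inverseʳ)
open import Data.Fin.Subset using (Subset)
open import Data.List.Base using (List; []; _∷_; take)
open import Data.List.Relation.Unary.All using (All)
open import Data.Nat.ListAction using (sum)
open import Data.Maybe.Base using (Maybe; just; nothing)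
open import Data.Product.Base using (_×_; _,_; proj₁; proj₂)
open import Data.Sum.Base using (inj₁; inj₂)
open import Data.Vec.Properties using (lookup∘updateAt; lookup∘updateAt′)
open import Data.Empty using (⊥; ⊥-elim)
open import Data.Unit.Base using (tt)
open import Function.Base using (_∘_; const)
open import Function.Bundles using (_⇔_; mk⇔; Equivalence)
import Function.Properties.Equivalence as ⇔
open import Relation.Nullary using (¬_; does; Dec; yes; no)
open import Relation.Nullary.Decidable.Core using (T?)
open import Relation.Nullary.Reflects using (ofʸ; ofⁿ)
open import Relation.Binary.Definitions using (tri<; tri≈; tri>)
open import Relation.Binary.PropositionalEquality
  using (_≡_; _≢_; refl; sym; trans; cong; cong₂; subst; subst₂; _≗_; module ≡-Reasoning)
import Algebra.Properties.CommutativeMonoid.Sum as CommutativeMonoidSum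
open import Algebra.Properties.CommutativeSemigroup +-commutativeSemigroup using (xy∙z≈zy∙x; x∙yz≈y∙xz)

[_] : Bool → ℕ
[ b ] = if b then 1 else 0

[]-mono : ∀ {a b} → (T a → T b) → [ a ] ≤ [ b ]
[]-mono {false}         _   = z≤n
[]-mono {true}  {true}  _   = ≤-refl
[]-mono {true}  {false} a⇒b = ⊥-elim (a⇒b tt)

[b]≤1 : ∀ b → [ b ] ≤ 1
[b]≤1 true  = ≤-refl
[b]≤1 false = z≤n

[]-partition : ∀ a b → [ a ∧ b ] + [ a ∧ not b ] ≡ [ a ]
[]-partition true  true  = refl
[]-partition true  false = refl
[]-partition false _     = refl

T-injective : ∀ {a b} → (T a ⇔ T b) → a ≡ b
T-injective {false} {false} _   = refl
T-injective {true}  {true}  _   = refl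
T-injective {true}  {false} a⇔b = ⊥-elim (Equivalence.to a⇔b tt)
T-injective {false} {true}  a⇔b = ⊥-elim (Equivalence.from a⇔b tt)

[b]+n≤k⇒n<k : ∀ {b} → T b → ∀ {n k} → [ b ] + n ≤ k → n < k
[b]+n≤k⇒n<k {true} _ le = le

n≤k⇒[b]+n≤k : ∀ {b} → ¬ T b → ∀ {n k} → n ≤ k → [ b ] + n ≤ k
n≤k⇒[b]+n≤k {false} _  le = le
n≤k⇒[b]+n≤k {true}  ¬t _  = ⊥-elim (¬t tt)

n<k⇒[b]+n<k : ∀ {b} → ¬ T b → ∀ {n k} → n < k → [ b ] + n < k
n<k⇒[b]+n<k {false} _  lt = lt
n<k⇒[b]+n<k {true}  ¬t _  = ⊥-elim (¬t tt)

n<[b]+n : ∀ {b} → T b → ∀ n → n < [ b ] + n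
n<[b]+n {true} _ n = n<1+n n

-- Counting and searching over Fin n

module Σ = CommutativeMonoidSum +-0-commutativeMonoid

countF≡sum : ∀ {n} (f : Fin n → Bool) → countF f ≡ Σ.sum ([_] ∘ f)
countF≡sum {zero}  f = refl
countF≡sum {suc n} f = cong ([ f zero ] +_) (countF≡sum (f ∘ suc))

countF-cong : ∀ {n} {f g : Fin n → Bool} → f ≗ g → countF f ≡ countF g
countF-cong {f = f} {g} f≗g = begin
  countF f          ≡⟨ countF≡sum f ⟩
  Σ.sum ([_] ∘ f)   ≡⟨ Σ.sum-cong-≗ (cong [_] ∘ f≗g) ⟩
  Σ.sum ([_] ∘ g)   ≡⟨ countF≡sum g ⟨
  countF g          ∎
  where open ≡-Reasoning

countF-mono : ∀ {n} {f g : Fin n → Bool} → (∀ x → T (f x) → T (g x)) → countF f ≤ countF g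
countF-mono {zero}  _   = z≤n
countF-mono {suc n} f⇒g = +-mono-≤ ([]-mono (f⇒g zero)) (countF-mono (f⇒g ∘ suc))

countF-partition : ∀ {n} (p q : Fin n → Bool)
                 → countF (λ u → p u ∧ q u) + countF (λ u → p u ∧ not (q u)) ≡ countF p
countF-partition {n} p q = begin
  countF (λ u → p u ∧ q u) + countF (λ u → p u ∧ not (q u))
    ≡⟨ cong₂ _+_ (countF≡sum (λ u → p u ∧ q u)) (countF≡sum (λ u → p u ∧ not (q u))) ⟩
  Σ.sum (λ u → [ p u ∧ q u ]) + Σ.sum (λ u → [ p u ∧ not (q u) ])
    ≡⟨ Σ.∑-distrib-+ {n} (λ u → [ p u ∧ q u ]) (λ u → [ p u ∧ not (q u) ]) ⟨
  Σ.sum (λ u → [ p u ∧ q u ] + [ p u ∧ not (q u) ])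
    ≡⟨ Σ.sum-cong-≗ (λ u → []-partition (p u) (q u)) ⟩
  Σ.sum ([_] ∘ p)
    ≡⟨ countF≡sum p ⟨
  countF p ∎
  where open ≡-Reasoning

countF-permute : ∀ {n} (f : Fin n → Bool) (σ : Permutation′ n) → countF f ≡ countF (f ∘ (σ ⟨$⟩ʳ_))
countF-permute f σ = begin
  countF f                     ≡⟨ countF≡sum f ⟩
  Σ.sum ([_] ∘ f)              ≡⟨ Σ.sum-permute ([_] ∘ f) σ ⟩
  Σ.sum ([_] ∘ f ∘ (σ ⟨$⟩ʳ_))  ≡⟨ countF≡sum (f ∘ (σ ⟨$⟩ʳ_)) ⟨
  countF (f ∘ (σ ⟨$⟩ʳ_))       ∎
  where open ≡-Reasoning

countF-cong-except : ∀ {n} {f g : Fin n → Bool} t → (∀ x → x ≢ t → f x ≡ g x)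
                   → countF f + [ g t ] ≡ countF g + [ f t ]
countF-cong-except {f = f} {g} zero f≈g = begin
  [ f zero ] + countF (f ∘ suc) + [ g zero ]
    ≡⟨ cong (λ c → [ f zero ] + c + [ g zero ]) (countF-cong (λ x → f≈g (suc x) λ ())) ⟩
  [ f zero ] + countF (g ∘ suc) + [ g zero ]
    ≡⟨ xy∙z≈zy∙x [ f zero ] _ [ g zero ] ⟩
  [ g zero ] + countF (g ∘ suc) + [ f zero ] ∎
  where open ≡-Reasoning
countF-cong-except {f = f} {g} (suc t) f≈g = begin
  [ f zero ] + countF (f ∘ suc) + [ g (suc t) ]
    ≡⟨ cong (λ b → [ b ] + _ + _) (f≈g zero λ ()) ⟩
  [ g zero ] + countF (f ∘ suc) + [ g (suc t) ]
    ≡⟨ +-assoc [ g zero ] _ _ ⟩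
  [ g zero ] + (countF (f ∘ suc) + [ g (suc t) ])
    ≡⟨ cong ([ g zero ] +_) (countF-cong-except t λ x x≢t → f≈g (suc x) (x≢t ∘ Finₚ.suc-injective)) ⟩
  [ g zero ] + (countF (g ∘ suc) + [ f (suc t) ])
    ≡⟨ +-assoc [ g zero ] _ _ ⟨
  [ g zero ] + countF (g ∘ suc) + [ f (suc t) ] ∎
  where open ≡-Reasoning

allF⇔ : ∀ {n} {f : Fin n → Bool} → T (allF f) ⇔ (∀ x → T (f x))
allF⇔ = mk⇔ to from
  where
  to : ∀ {n} {f : Fin n → Bool} → T (allF f) → ∀ x → T (f x)
  to {f = f} h zero with f zero | h
  ... | true | _ = tt
  to {f = f} h (suc x) with f zero | h
  ... | true | h′ = to {f = f ∘ suc} h′ x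
  from : ∀ {n} {f : Fin n → Bool} → (∀ x → T (f x)) → T (allF f)
  from {zero}  _ = tt
  from {suc n} {f} h with f zero | h zero
  ... | true | _ = from {f = f ∘ suc} (h ∘ suc)

allF-crossing⇔ : ∀ {n} (l r p q : Fin n → Bool) → (∀ j → T (l j) → ¬ T (r j))
  → T (allF (λ j → not (l j ∨ r j) ∨ (l j ∧ p j) ∨ (r j ∧ q j)))
    ⇔ ((∀ j → T (l j) → T (p j)) × (∀ j → T (r j) → T (q j)))
allF-crossing⇔ l r p q excl = ⇔.trans allF⇔ (mk⇔
  (λ h → (λ j → proj₁ (to (l j) (r j) (p j) (q j) (excl j) (h j)))
       , (λ j → proj₂ (to (l j) (r j) (p j) (q j) (excl j) (h j))))
  (λ (hl , hr) j → from (l j) (r j) (p j) (q j) (hl j) (hr j)))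
  where
  to : ∀ l r p q → (T l → ¬ T r) → T (not (l ∨ r) ∨ (l ∧ p) ∨ (r ∧ q)) → (T l → T p) × (T r → T q)
  to false false _     _ _    _  = (λ ()) , (λ ())
  to true  true  _     _ excl _  = ⊥-elim (excl tt tt)
  to true  false true  _ _    _  = const tt , (λ ())
  to false true  _     _ _    hq = (λ ()) , const hq
  from : ∀ l r p q → (T l → T p) → (T r → T q) → T (not (l ∨ r) ∨ (l ∧ p) ∨ (r ∧ q))
  from false false _ _ _  _  = tt
  from true  r     p _ lp _  with p | lp tt
  ... | true | _ = tt
  from false true  _ _ _  rq = rq tt

data First {n} (f : Fin n → Bool) : Maybe (Fin n) → Set where
  none : (∀ x → ¬ T (f x)) → First f nothing
  some : ∀ {x} → T (f x) → (∀ y → toℕ y < toℕ x → ¬ T (f y)) → First f (just x)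

first : ∀ {n} (f : Fin n → Bool) → First f (firstF f)
first {zero}  f = none (λ ())
first {suc n} f with f zero in f0
... | true  = some (Equivalence.from T-≡ f0) (λ _ ())
... | false with firstF (f ∘ suc) | first (f ∘ suc)
...   | nothing | none ¬f′ = none λ { zero → subst T f0 ; (suc x) → ¬f′ x }
...   | just x  | some fx below = some fx λ { zero _ → subst T f0 ; (suc y) (s≤s y<x) → below y y<x }

data Last {n} (f : Fin n → Bool) : Maybe (Fin n) → Set where
  none : (∀ x → ¬ T (f x)) → Last f nothing
  some : ∀ {x} → T (f x) → (∀ y → toℕ x < toℕ y → ¬ T (f y)) → Last f (just x)

last : ∀ {n} (f : Fin n → Bool) → Last f (lastF f)
last {zero}  f = none (λ ())
last {suc n} f with lastF (f ∘ suc) | last (f ∘ suc)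
... | just x  | some fx above = some fx λ { zero () ; (suc y) (s≤s x<y) → above y x<y }
... | nothing | none ¬f′ with f zero in f0
...   | true  = some (Equivalence.from T-≡ f0) λ { zero () ; (suc y) _ → ¬f′ y }
...   | false = none λ { zero → subst T f0 ; (suc x) → ¬f′ x }

-- The sign of a ⊖ b

data ⊖-Sign (a b : ℕ) : Set where
  nonnegative : ∀ k → a ≡ b + k → a ⊖ b ≡ ℤ.+ k → ⊖-Sign a b
  negative    : ∀ k → b ≡ suc (a + k) → a ⊖ b ≡ ℤ.-[1+ k ] → ⊖-Sign a b

⊖-sign : ∀ a b → ⊖-Sign a b
⊖-sign a       zero    = nonnegative a refl refl
⊖-sign zero    (suc b) = negative b refl refl
⊖-sign (suc a) (suc b) with ⊖-sign a b
... | nonnegative k a≡b+k   a⊖b = nonnegative k (cong suc a≡b+k)   (trans ([1+m]⊖[1+n]≡m⊖n a b) a⊖b)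
... | negative    k b≡1+a+k a⊖b = negative    k (cong suc b≡1+a+k) (trans ([1+m]⊖[1+n]≡m⊖n a b) a⊖b)

0≤ᵇ⊖⇔ : ∀ a b → T (ℤ.0ℤ ℤ.≤ᵇ a ⊖ b) ⇔ b ≤ a
0≤ᵇ⊖⇔ a b with ⊖-sign a b
... | nonnegative k refl a⊖b rewrite a⊖b = mk⇔ (const (m≤m+n b k)) (const tt)
... | negative    k refl a⊖b rewrite a⊖b = mk⇔ (λ ()) (⊥-elim ∘ m+n≮m a k)

1≤ᵇ⊖⇔ : ∀ a b → T (ℤ.1ℤ ℤ.≤ᵇ a ⊖ b) ⇔ b < a
1≤ᵇ⊖⇔ a b with ⊖-sign a b
... | nonnegative zero    refl a⊖b rewrite a⊖b = mk⇔ (λ ()) (⊥-elim ∘ <-irrefl (sym (+-identityʳ b)))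
... | nonnegative (suc k) refl a⊖b rewrite a⊖b = mk⇔ (const (m<m+n b z<s)) (const tt)
... | negative    k       refl a⊖b rewrite a⊖b = mk⇔ (λ ()) (⊥-elim ∘ m+n≮m a k ∘ <⇒≤)

⊖≤ᵇ-1⇔ : ∀ a b → T (a ⊖ b ℤ.≤ᵇ ℤ.-1ℤ) ⇔ a < b
⊖≤ᵇ-1⇔ a b with ⊖-sign a b
... | nonnegative k refl a⊖b rewrite a⊖b = mk⇔ (λ ()) (⊥-elim ∘ m+n≮m b k)
... | negative    k refl a⊖b rewrite a⊖b = mk⇔ (const (s≤s (m≤m+n a k))) (const tt)

⊖≤ᵇ-2⇔ : ∀ a b → T (a ⊖ b ℤ.≤ᵇ ℤ.-[1+ 1 ]) ⇔ suc a < b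
⊖≤ᵇ-2⇔ a b with ⊖-sign a b
... | nonnegative k       refl a⊖b rewrite a⊖b = mk⇔ (λ ()) (⊥-elim ∘ m+n≮m b k ∘ <-trans (n<1+n _))
... | negative    zero    refl a⊖b rewrite a⊖b = mk⇔ (λ ()) (⊥-elim ∘ <-irrefl (cong suc (sym (+-identityʳ a))))
... | negative    (suc k) refl a⊖b rewrite a⊖b = mk⇔ (const (s≤s (m<m+n a z<s))) (const tt)

⊖≟0⇔ : ∀ a b → T (does (a ⊖ b ≟ℤ ℤ.0ℤ)) ⇔ a ≡ b
⊖≟0⇔ a b with ⊖-sign a b
... | nonnegative zero    refl a⊖b rewrite a⊖b = mk⇔ (const (+-identityʳ b)) (const tt)
... | nonnegative (suc k) refl a⊖b rewrite a⊖b = mk⇔ (λ ()) (⊥-elim ∘ m+1+n≢m b)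
... | negative    k       refl a⊖b rewrite a⊖b = mk⇔ (λ ()) (⊥-elim ∘ m≢1+m+n a)

-- Arithmetic of toggling a mark

≤-shift⇔ : ∀ {u l u′ l′ x y} → u′ + x ≡ u + y → l′ + x ≡ l + y → (u′ ≤ l′ ⇔ u ≤ l)
≤-shift⇔ {u} {l} {u′} {l′} {x} {y} eu el = mk⇔
  (λ u′≤l′ → +-cancelʳ-≤ y u l (subst₂ _≤_ eu el (+-monoˡ-≤ x u′≤l′)))
  (λ u≤l → +-cancelʳ-≤ x u′ l′ (subst₂ _≤_ (sym eu) (sym el) (+-monoˡ-≤ y u≤l)))

-- u, l (u′, l′) are bind^U and bind^L of an edge e before (after) toggling the mark m of
-- e_t; a and b say whether e_t lies left of e at the upper and at the lower endpoints.
≤-toggle⇔ : ∀ m a b {u l u′ l′}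
  → u′ + [ a ∧ m ] ≡ u + [ a ∧ not m ]
  → l′ + [ b ∧ m ] ≡ l + [ b ∧ not m ]
  → (T a → ¬ T b → [ m ] + l < u)
  → (¬ T a → T b → [ m ] + u ≤ l)
  → (u′ ≤ l′ ⇔ u ≤ l)
≤-toggle⇔ m false false eu el _ _ = ≤-shift⇔ eu el
≤-toggle⇔ m true  true  eu el _ _ = ≤-shift⇔ eu el
≤-toggle⇔ m true  false {u} {l} {u′} {l′} eu el right _ =
  mk⇔ (⊥-elim ∘ <⇒≱ l′<u′) (⊥-elim ∘ <⇒≱ (≤-<-trans (m≤n+m l [ m ]) m+l<u))
  where
  m+l<u : [ m ] + l < u
  m+l<u = right tt (λ ())
  open ≤-Reasoning
  l′<u′ : l′ < u′
  l′<u′ = +-cancelʳ-< [ m ] l′ u′ (begin-strict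
    l′ + [ m ]     ≡⟨ cong (_+ [ m ]) (+-cancelʳ-≡ 0 l′ l el) ⟩
    l + [ m ]      ≡⟨ +-comm l [ m ] ⟩
    [ m ] + l      <⟨ m+l<u ⟩
    u              ≤⟨ m≤m+n u [ not m ] ⟩
    u + [ not m ]  ≡⟨ eu ⟨
    u′ + [ m ]     ∎)
≤-toggle⇔ m false true {u} {l} {u′} {l′} eu el _ left =
  mk⇔ (const (≤-trans (m≤n+m u [ m ]) m+u≤l)) (const u′≤l′)
  where
  m+u≤l : [ m ] + u ≤ l
  m+u≤l = left (λ ()) tt
  open ≤-Reasoning
  u′≤l′ : u′ ≤ l′
  u′≤l′ = +-cancelʳ-≤ [ m ] u′ l′ (begin
    u′ + [ m ]     ≡⟨ cong (_+ [ m ]) (+-cancelʳ-≡ 0 u′ u eu) ⟩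
    u + [ m ]      ≡⟨ +-comm u [ m ] ⟩
    [ m ] + u      ≤⟨ m+u≤l ⟩
    l              ≤⟨ m≤m+n l [ not m ] ⟩
    l + [ not m ]  ≡⟨ el ⟨
    l′ + [ m ]     ∎)

-- Binding indices

bindAt : ∀ {n} → (Fin n → Bool) → ℕ → ℕ
bindAt P x = suc (countF (λ u → (toℕ u <ᵇ x) ∧ P u))

bindAt-mono : ∀ {n} (P : Fin n → Bool) {x y} → x ≤ y → bindAt P x ≤ bindAt P y
bindAt-mono P {x} {y} x≤y = s≤s (countF-mono {f = λ u → (toℕ u <ᵇ x) ∧ P u} λ u h →
  let u<x , Pu = Equivalence.to T-∧ h in
  Equivalence.from T-∧ (<⇒<ᵇ (<-≤-trans (<ᵇ⇒< _ _ u<x) x≤y) , Pu))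

countF-below-suc : ∀ {n} (P : Fin n → Bool) a
  → [ P a ] + countF (λ u → (toℕ u <ᵇ toℕ a) ∧ P u) ≡ countF (λ u → (toℕ u <ᵇ suc (toℕ a)) ∧ P u)
countF-below-suc P zero    = refl
countF-below-suc P (suc a) =
  trans (x∙yz≈y∙xz [ P (suc a) ] [ P zero ] _) (cong ([ P zero ] +_) (countF-below-suc (P ∘ suc) a))

bindAt-step : ∀ {n} (P : Fin n → Bool) a {x} → toℕ a < x → [ P a ] + bindAt P (toℕ a) ≤ bindAt P x
bindAt-step P a {x} a<x = begin
  [ P a ] + bindAt P (toℕ a)  ≡⟨ +-suc [ P a ] _ ⟩
  suc ([ P a ] + _)           ≡⟨ cong suc (countF-below-suc P a) ⟩
  bindAt P (suc (toℕ a))      ≤⟨ bindAt-mono P a<x ⟩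
  bindAt P x                  ∎
  where open ≤-Reasoning

bindAt-update : ∀ {n} {P Q : Fin n → Bool} t → (∀ u → u ≢ t → P u ≡ Q u) → ∀ x
  → bindAt Q x + [ (toℕ t <ᵇ x) ∧ P t ] ≡ bindAt P x + [ (toℕ t <ᵇ x) ∧ Q t ]
bindAt-update t P≈Q x =
  cong suc (countF-cong-except t λ u u≢t → cong ((toℕ u <ᵇ x) ∧_) (sym (P≈Q u u≢t)))

-- Blocks

∸<⇔<+ : ∀ {n x c} → n ≤ x → (x ∸ n < c ⇔ x < n + c)
∸<⇔<+ {n} {x} {c} n≤x = mk⇔
  (λ h → subst (_< n + c) (m+[n∸m]≡n n≤x) (+-monoʳ-< n h))
  (λ h → +-cancelˡ-< n _ _ (subst (_< n + c) (sym (m+[n∸m]≡n n≤x)) h))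

block<⇔<prefix : ∀ ns r {x} → x < sum ns → (block ns x < r ⇔ x < sum (take r ns))
block<⇔<prefix ns       zero    _ = mk⇔ (λ ()) (λ ())
block<⇔<prefix []       (suc r) ()
block<⇔<prefix (n ∷ ns) (suc r) {x} x<N with x <ᵇ n | <ᵇ-reflects-< x n
... | true  | ofʸ x<n = mk⇔ (const (≤-trans x<n (m≤m+n n _))) (const z<s)
... | false | ofⁿ x≮n =
  ⇔.trans (mk⇔ s<s⁻¹ s<s) (⇔.trans (block<⇔<prefix ns r x∸n<N) (∸<⇔<+ n≤x))
  where
  n≤x : n ≤ x
  n≤x = ≮⇒≥ x≮n
  x∸n<N : x ∸ n < sum ns
  x∸n<N = Equivalence.from (∸<⇔<+ n≤x) x<N

block-mono : ∀ ns {x y} → x ≤ y → y < sum ns → block ns x ≤ block ns y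
block-mono ns {x} {y} x≤y y<N = ≮⇒≥ λ by<bx → <⇒≱ y<p (≤-trans (p≤x by<bx) x≤y)
  where
  p : ℕ
  p = sum (take (suc (block ns y)) ns)
  y<p : y < p
  y<p = Equivalence.to (block<⇔<prefix ns _ y<N) (n<1+n _)
  p≤x : block ns y < block ns x → p ≤ x
  p≤x by<bx = ≮⇒≥ λ x<p →
    <⇒≱ by<bx (s≤s⁻¹ (Equivalence.from (block<⇔<prefix ns _ (≤-<-trans x≤y y<N)) x<p))

-- Marked perfect matchings

module _ (ns : List ℕ) (π : Permutation′ (sum ns)) where

  lo : Fin (sum ns) → ℕ
  lo j = toℕ (π ⟨$⟩ʳ j)

  lo-injective : ∀ {i j} → lo i ≡ lo j → i ≡ j
  lo-injective {i} {j} eq = begin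
    i                  ≡⟨ inverseˡ π ⟨
    π ⟨$⟩ˡ (π ⟨$⟩ʳ i)  ≡⟨ cong (π ⟨$⟩ˡ_) (Finₚ.toℕ-injective eq) ⟩
    π ⟨$⟩ˡ (π ⟨$⟩ʳ j)  ≡⟨ inverseˡ π ⟩
    j                  ∎
    where open ≡-Reasoning

  prefix : ℕ → ℕ
  prefix r = sum (take r ns)

  block<⇔<prefixᶠ : ∀ (x : Fin (sum ns)) {r} → block ns (toℕ x) < r ⇔ toℕ x < prefix r
  block<⇔<prefixᶠ x = block<⇔<prefix ns _ (Finₚ.toℕ<n x)

  <prefix : ∀ (x : Fin (sum ns)) {r} → block ns (toℕ x) < r → toℕ x < prefix r
  <prefix x = Equivalence.to (block<⇔<prefixᶠ x)

  prefix≤ : ∀ (x : Fin (sum ns)) {r} → r ≤ block ns (toℕ x) → prefix r ≤ toℕ x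
  prefix≤ x r≤b = ≮⇒≥ λ x<p → <⇒≱ (Equivalence.from (block<⇔<prefixᶠ x) x<p) r≤b

  sameBlock⇒sameSide : ∀ (x y : Fin (sum ns)) r → block ns (toℕ x) ≡ block ns (toℕ y)
                     → (toℕ x <ᵇ prefix r) ≡ (toℕ y <ᵇ prefix r)
  sameBlock⇒sameSide x y r bx≡by = T-injective (mk⇔ (move x y bx≡by) (move y x (sym bx≡by)))
    where
    move : ∀ a b → block ns (toℕ a) ≡ block ns (toℕ b) → T (toℕ a <ᵇ prefix r) → T (toℕ b <ᵇ prefix r)
    move a b ba≡bb a<p =
      <⇒<ᵇ (<prefix b (subst (_< r) ba≡bb (Equivalence.from (block<⇔<prefixᶠ a) (<ᵇ⇒< _ _ a<p))))

  block-monoᶠ : ∀ {x y : Fin (sum ns)} → toℕ x ≤ toℕ y → block ns (toℕ x) ≤ block ns (toℕ y)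
  block-monoᶠ {y = y} x≤y = block-mono ns x≤y (Finₚ.toℕ<n y)

  homogeneous⇔ : ∀ j → T (homogeneous ns π j) ⇔ block ns (toℕ j) ≡ block ns (lo j)
  homogeneous⇔ j = mk⇔ (≡ᵇ⇒≡ _ _) (≡⇒≡ᵇ _ _)

  CrossesFromLeft : Fin (sum ns) → Fin (sum ns) → Set
  CrossesFromLeft j i = toℕ j < toℕ i × lo i < lo j

  crossesFromLeft⇔ : ∀ j i → T (crossesFromLeft ns π j i) ⇔ CrossesFromLeft j i
  crossesFromLeft⇔ j i = mk⇔
    (λ h → let j<i , πi<πj = Equivalence.to T-∧ h in <ᵇ⇒< _ _ j<i , <ᵇ⇒< _ _ πi<πj)
    (λ (j<i , πi<πj) → Equivalence.from T-∧ (<⇒<ᵇ j<i , <⇒<ᵇ πi<πj))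

  crossing⇔ : ∀ i {p q : Fin (sum ns) → Bool} {P Q : Fin (sum ns) → Set}
    → (∀ j → T (p j) ⇔ P j) → (∀ j → T (q j) ⇔ Q j)
    → T (allF (λ j → not (cross ns π j i) ∨ (crossesFromLeft ns π j i ∧ p j)
                                          ∨ (crossesFromRight ns π j i ∧ q j)))
      ⇔ ((∀ j → CrossesFromLeft j i → P j) × (∀ j → CrossesFromLeft i j → Q j))
  crossing⇔ i {p} {q} p⇔P q⇔Q =
    ⇔.trans (allF-crossing⇔ _ _ p q excl) (mk⇔
      (λ (hl , hr) → (λ j c → to (p⇔P j) (hl j (from (crossesFromLeft⇔ j i) c)))
                   , (λ j c → to (q⇔Q j) (hr j (from (crossesFromLeft⇔ i j) c))))
      (λ (hl , hr) → (λ j c → from (p⇔P j) (hl j (to (crossesFromLeft⇔ j i) c)))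
                   , (λ j c → from (q⇔Q j) (hr j (to (crossesFromLeft⇔ i j) c)))))
    where
    open Equivalence
    excl : ∀ j → T (crossesFromLeft ns π j i) → ¬ T (crossesFromLeft ns π i j)
    excl j l r = <-asym (proj₁ (to (crossesFromLeft⇔ j i) l)) (proj₁ (to (crossesFromLeft⇔ i j) r))

  module _ (S : Subset (sum ns)) where

    markedᴸ : Fin (sum ns) → Bool
    markedᴸ v = marked ns π S (π ⟨$⟩ˡ v)

    bindUAt bindLAt : ℕ → ℕ
    bindUAt = bindAt (marked ns π S)
    bindLAt = bindAt markedᴸ

    -- Definitionally bindU j and bindL (π j), so that bdiff j reduces to L j ⊖ U j.
    U L : Fin (sum ns) → ℕ
    U j = bindUAt (toℕ j)
    L j = bindLAt (lo j)

    m : Fin (sum ns) → ℕ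
    m j = [ marked ns π S j ]

    bdiff≥0⇔ : ∀ j → T (ℤ.0ℤ ℤ.≤ᵇ bdiff ns π S j) ⇔ U j ≤ L j
    bdiff≥0⇔ j = 0≤ᵇ⊖⇔ (L j) (U j)

    bdiff≤-1⇔ : ∀ j → T (bdiff ns π S j ℤ.≤ᵇ ℤ.-1ℤ) ⇔ L j < U j
    bdiff≤-1⇔ j = ⊖≤ᵇ-1⇔ (L j) (U j)

    bdiff≡0⇔ : ∀ j → T (does (bdiff ns π S j ≟ℤ ℤ.0ℤ)) ⇔ L j ≡ U j
    bdiff≡0⇔ j = ⊖≟0⇔ (L j) (U j)

    U-step : ∀ a {x} → toℕ a < x → m a + U a ≤ bindUAt x
    U-step = bindAt-step (marked ns π S)

    L-step : ∀ a {y} → lo a < y → m a + L a ≤ bindLAt y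
    L-step a lo<y = subst (λ b → [ b ] + L a ≤ _) (cong (marked ns π S) (inverseˡ π))
                          (bindAt-step markedᴸ (π ⟨$⟩ʳ a) lo<y)

    Toggleable : Fin (sum ns) → Set
    Toggleable t = (∀ j → CrossesFromLeft j t → m t + U j ≤ L j)
                 × (∀ j → CrossesFromLeft t j → m t + L j < U j)

    convertible⇔toggleable : ∀ i → T (convertible ns π S i) ⇔ Toggleable i
    convertible⇔toggleable i = by-mark (marked ns π S i)
      where
      -- convertible branches on the mark of e_i; abstracting over that bit lets both sides reduce.
      by-mark : ∀ b → T (if b
        then allF (λ j → not (cross ns π j i) ∨ (crossesFromLeft ns π j i ∧ (ℤ.1ℤ ℤ.≤ᵇ bdiff ns π S j))
                                              ∨ (crossesFromRight ns π j i ∧ (bdiff ns π S j ℤ.≤ᵇ ℤ.-[1+ 1 ])))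
        else allF (λ j → not (cross ns π j i) ∨ (crossesFromLeft ns π j i ∧ (ℤ.0ℤ ℤ.≤ᵇ bdiff ns π S j))
                                              ∨ (crossesFromRight ns π j i ∧ (bdiff ns π S j ℤ.≤ᵇ ℤ.-1ℤ))))
        ⇔ ((∀ j → CrossesFromLeft j i → [ b ] + U j ≤ L j) × (∀ j → CrossesFromLeft i j → [ b ] + L j < U j))
      by-mark true  = crossing⇔ i (λ j → 1≤ᵇ⊖⇔ (L j) (U j)) (λ j → ⊖≤ᵇ-2⇔ (L j) (U j))
      by-mark false = crossing⇔ i (λ j → 0≤ᵇ⊖⇔ (L j) (U j)) (λ j → ⊖≤ᵇ-1⇔ (L j) (U j))

    negativeHomogeneous : Fin (sum ns) → Bool
    negativeHomogeneous j = homogeneous ns π j ∧ (bdiff ns π S j ℤ.≤ᵇ ℤ.-1ℤ)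

    ¬negative⇒nonneg : ∀ {j} → ¬ T (negativeHomogeneous j) → T (homogeneous ns π j) → U j ≤ L j
    ¬negative⇒nonneg {j} ¬neg hj = ≮⇒≥ λ L<U →
      ¬neg (Equivalence.from T-∧ (hj , Equivalence.from (bdiff≤-1⇔ j) L<U))

    zeroCrossing : Fin (sum ns) → Fin (sum ns) → Bool
    zeroCrossing i j = (_<F_ ns π j i) ∧ homogeneous ns π j ∧ does (bdiff ns π S j ≟ℤ ℤ.0ℤ) ∧ cross ns π j i

    zeroCrossing⇔ : ∀ i j → T (zeroCrossing i j) ⇔ (CrossesFromLeft j i × T (homogeneous ns π j) × L j ≡ U j)
    zeroCrossing⇔ i j = mk⇔ to from
      where
      open Equivalence using () renaming (to to ⇒; from to ⇐)
      to : T (zeroCrossing i j) → CrossesFromLeft j i × T (homogeneous ns π j) × L j ≡ U j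
      to z with j<i , rest ← ⇒ T-∧ z with hj , rest ← ⇒ T-∧ rest with Lj≡Uj , c ← ⇒ T-∧ rest
        with ⇒ T-∨ c
      ... | inj₁ fromLeft  = ⇒ (crossesFromLeft⇔ j i) fromLeft , hj , ⇒ (bdiff≡0⇔ j) Lj≡Uj
      ... | inj₂ fromRight = ⊥-elim (<-asym (<ᵇ⇒< _ _ j<i) (proj₁ (⇒ (crossesFromLeft⇔ i j) fromRight)))
      from : CrossesFromLeft j i × T (homogeneous ns π j) × L j ≡ U j → T (zeroCrossing i j)
      from (c , hj , Lj≡Uj) = ⇐ T-∧ (<⇒<ᵇ (proj₁ c) , ⇐ T-∧ (hj , ⇐ T-∧ (⇐ (bdiff≡0⇔ j) Lj≡Uj ,
                               ⇐ T-∨ (inj₁ (⇐ (crossesFromLeft⇔ j i) c)))))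

    nonneg⇒left : ∀ {t} → U t ≤ L t → ∀ j → CrossesFromLeft j t → m t + U j ≤ L j
    nonneg⇒left {t} Ut≤Lt j (j<t , πt<πj) = begin
      m t + U j  ≤⟨ +-monoʳ-≤ (m t) (≤-trans (m≤n+m (U j) (m j)) (U-step j j<t)) ⟩
      m t + U t  ≤⟨ +-monoʳ-≤ (m t) Ut≤Lt ⟩
      m t + L t  ≤⟨ L-step t πt<πj ⟩
      L j        ∎
      where open ≤-Reasoning

    module _ (isMarked : IsMarked ns π S) where

      unmarked⇒homogeneous : ∀ {u} → ¬ T (marked ns π S u) → T (homogeneous ns π u)
      unmarked⇒homogeneous {u} ¬mu with homogeneous ns π u in h
      ... | true  = tt
      ... | false = ⊥-elim (¬mu (Equivalence.from T-≡ (isMarked u h)))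

      inhomogeneous⇒marked : ∀ {u} → ¬ T (homogeneous ns π u) → T (marked ns π S u)
      inhomogeneous⇒marked {u} ¬h with homogeneous ns π u in h
      ... | true  = ⊥-elim (¬h tt)
      ... | false = Equivalence.from T-≡ (isMarked u h)

      -- Unmarked edges are homogeneous, so none of them crosses a block boundary.
      balanced : ∀ r → bindUAt (prefix r) ≡ bindLAt (prefix r)
      balanced r = cong suc (+-cancelʳ-≡ _ _ _ (begin
        countF (λ u → below u ∧ marked ns π S u) + unmarkedBelow
          ≡⟨ countF-partition below (marked ns π S) ⟩
        countF below
          ≡⟨ countF-partition below markedᴸ ⟨
        countF (λ v → below v ∧ markedᴸ v) + countF (λ v → below v ∧ not (markedᴸ v))
          ≡⟨ cong (countF (λ v → below v ∧ markedᴸ v) +_) unmarked-lower ⟩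
        countF (λ v → below v ∧ markedᴸ v) + unmarkedBelow ∎))
        where
        open ≡-Reasoning
        below : Fin (sum ns) → Bool
        below u = toℕ u <ᵇ prefix r
        unmarkedBelow : ℕ
        unmarkedBelow = countF (λ u → below u ∧ not (marked ns π S u))
        pointwise : ∀ u → below u ∧ not (marked ns π S u)
                        ≡ (lo u <ᵇ prefix r) ∧ not (marked ns π S (π ⟨$⟩ˡ (π ⟨$⟩ʳ u)))
        pointwise u rewrite inverseˡ π {u} with marked ns π S u in mu
        ... | true  = trans (∧-zeroʳ _) (sym (∧-zeroʳ _))
        ... | false = cong (_∧ true) (sameBlock⇒sameSide u (π ⟨$⟩ʳ u) r
                        (Equivalence.to (homogeneous⇔ u) (unmarked⇒homogeneous (subst T mu))))
        unmarked-lower : countF (λ v → below v ∧ not (markedᴸ v)) ≡ unmarkedBelow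
        unmarked-lower = trans (countF-permute _ π) (sym (countF-cong pointwise))

      nonneg-across : ∀ j {r} → toℕ j ≤ prefix r → prefix r ≤ lo j → U j ≤ L j
      nonneg-across j {r} j≤p p≤πj = begin
        U j                  ≤⟨ bindAt-mono (marked ns π S) j≤p ⟩
        bindUAt (prefix r)   ≡⟨ balanced r ⟩
        bindLAt (prefix r)   ≤⟨ bindAt-mono markedᴸ p≤πj ⟩
        L j                  ∎
        where open ≤-Reasoning

      neg-across : ∀ a b {r} → lo a < prefix r → prefix r ≤ toℕ b → m a + L a ≤ U b
      neg-across a b {r} πa<p p≤b = begin
        m a + L a            ≤⟨ L-step a πa<p ⟩
        bindLAt (prefix r)   ≡⟨ balanced r ⟨
        bindUAt (prefix r)   ≤⟨ bindAt-mono (marked ns π S) p≤b ⟩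
        U b                  ∎
        where open ≤-Reasoning

      ascending-nonneg : ∀ j → block ns (toℕ j) < block ns (lo j) → U j ≤ L j
      ascending-nonneg j up =
        nonneg-across j {suc (block ns (toℕ j))} (<⇒≤ (<prefix j (n<1+n _))) (prefix≤ (π ⟨$⟩ʳ j) up)

      lowest⇒toggleable : ∀ t → T (homogeneous ns π t)
        → (∀ j → lo j < lo t → ¬ T (homogeneous ns π j))
        → (∀ j → T (homogeneous ns π j) → U j ≤ L j)
        → Toggleable t
      lowest⇒toggleable t ht lowest nonneg = nonneg⇒left (nonneg t ht) , right
        where
        open ≤-Reasoning
        r : ℕ
        r = block ns (toℕ t)
        r≡ : r ≡ block ns (lo t)
        r≡ = Equivalence.to (homogeneous⇔ t) ht
        right : ∀ j → CrossesFromLeft t j → m t + L j < U j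
        right j (t<j , πj<πt) with <-cmp (block ns (lo j)) r
        ... | tri< πj-earlier _ _ = begin-strict
          m t + L j  <⟨ +-monoʳ-< (m t) ([b]+n≤k⇒n<k mj
                          (neg-across j t {r} (<prefix (π ⟨$⟩ʳ j) πj-earlier) (prefix≤ t ≤-refl))) ⟩
          m t + U t  ≤⟨ U-step t t<j ⟩
          U j        ∎
          where
          mj : T (marked ns π S j)
          mj = inhomogeneous⇒marked (lowest j πj<πt)
        ... | tri≈ _ πj-same _ = begin-strict
          m t + L j  <⟨ +-monoʳ-< (m t) ([b]+n≤k⇒n<k mj (L-step j πj<πt)) ⟩
          m t + L t  ≤⟨ neg-across t j {suc r} (<prefix (π ⟨$⟩ʳ t) (s≤s (≤-reflexive (sym r≡))))
                                               (prefix≤ j j-later) ⟩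
          U j        ∎
          where
          mj : T (marked ns π S j)
          mj = inhomogeneous⇒marked (lowest j πj<πt)
          j-later : suc r ≤ block ns (toℕ j)
          j-later = ≤∧≢⇒< (block-monoᶠ (<⇒≤ t<j)) λ r≡bj →
            lowest j πj<πt (Equivalence.from (homogeneous⇔ j) (trans (sym r≡bj) (sym πj-same)))
        ... | tri> _ _ πj-later =
          ⊥-elim (<⇒≱ πj-later (subst (block ns (lo j) ≤_) (sym r≡) (block-monoᶠ (<⇒≤ πj<πt))))

      firstNegative-marked : ∀ i → T (homogeneous ns π i) → L i < U i
        → (∀ j → toℕ j < toℕ i → T (homogeneous ns π j) → U j ≤ L j)
        → ¬ T (convertible ns π S i) → T (marked ns π S i)
      firstNegative-marked i hi neg earlier ¬conv with T? (marked ns π S i)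
      ... | yes mi  = mi
      ... | no  ¬mi = ⊥-elim (¬conv (Equivalence.from (convertible⇔toggleable i) (left , right)))
        where
        open ≤-Reasoning
        left-nonneg : ∀ j → CrossesFromLeft j i → Dec (T (homogeneous ns π j)) → U j ≤ L j
        left-nonneg j (j<i , _)      (yes hj) = earlier j j<i hj
        left-nonneg j (j<i , πi<πj) (no ¬hj) = ascending-nonneg j (≤∧≢⇒< (begin
          block ns (toℕ j)  ≤⟨ block-monoᶠ (<⇒≤ j<i) ⟩
          block ns (toℕ i)  ≡⟨ Equivalence.to (homogeneous⇔ i) hi ⟩
          block ns (lo i)   ≤⟨ block-monoᶠ (<⇒≤ πi<πj) ⟩
          block ns (lo j)   ∎) (¬hj ∘ Equivalence.from (homogeneous⇔ j)))
        left : ∀ j → CrossesFromLeft j i → m i + U j ≤ L j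
        left j c = n≤k⇒[b]+n≤k ¬mi (left-nonneg j c (T? (homogeneous ns π j)))
        right : ∀ j → CrossesFromLeft i j → m i + L j < U j
        right j (i<j , πj<πi) = n<k⇒[b]+n<k ¬mi (begin-strict
          L j  ≤⟨ ≤-trans (m≤n+m (L j) (m j)) (L-step j πj<πi) ⟩
          L i  <⟨ neg ⟩
          U i  ≤⟨ ≤-trans (m≤n+m (U i) (m i)) (U-step i i<j) ⟩
          U j  ∎)

      -- An unmarked edge crossing e_t from the right is homogeneous, so it cannot lie left of
      -- e_i: that would contradict the minimality of i or the maximality of t.
      lastZero⇒toggleable : ∀ i t → T (marked ns π S i) → L i < U i
        → (∀ j → toℕ j < toℕ i → T (homogeneous ns π j) → U j ≤ L j)
        → CrossesFromLeft t i → L t ≡ U t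
        → (∀ a → toℕ t < toℕ a → CrossesFromLeft a i → T (homogeneous ns π a) → L a ≢ U a)
        → Toggleable t
      lastZero⇒toggleable i t mi neg earlier (t<i , πi<πt) Lt≡Ut latest =
        nonneg⇒left (≤-reflexive (sym Lt≡Ut)) , right
        where
        open ≤-Reasoning
        right : ∀ a → CrossesFromLeft t a → m t + L a < U a
        right a (t<a , πa<πt) = by-mark (T? (marked ns π S a))
          where
          through-t : m t + (m a + L a) ≤ U a
          through-t = begin
            m t + (m a + L a)  ≤⟨ +-monoʳ-≤ (m t) (L-step a πa<πt) ⟩
            m t + L t          ≡⟨ cong (m t +_) Lt≡Ut ⟩
            m t + U t          ≤⟨ U-step t t<a ⟩
            U a                ∎
          La≤Ua : L a ≤ U a
          La≤Ua = ≤-trans (≤-trans (m≤n+m (L a) (m a)) (m≤n+m _ (m t))) through-t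
          before-i : toℕ a < toℕ i → T (homogeneous ns π a) → U a ≤ L a → ⊥
          before-i a<i ha Ua≤La with <-cmp (lo a) (lo i)
          ... | tri< πa<πi _ _ = <⇒≱ (begin-strict
            L a  ≤⟨ ≤-trans (m≤n+m (L a) (m a)) (L-step a πa<πi) ⟩
            L i  <⟨ [b]+n≤k⇒n<k mi (L-step i πi<πt) ⟩
            L t  ≡⟨ Lt≡Ut ⟩
            U t  ≤⟨ ≤-trans (m≤n+m (U t) (m t)) (U-step t t<a) ⟩
            U a  ∎) Ua≤La
          ... | tri≈ _ πa≡πi _ = <⇒≢ a<i (cong toℕ (lo-injective πa≡πi))
          ... | tri> _ _ πi<πa = latest a t<a (a<i , πi<πa) ha (≤-antisym La≤Ua Ua≤La)
          after-i : toℕ i < toℕ a → m t + L a ≤ U i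
          after-i i<a with lo a <? lo i
          ... | yes πa<πi = begin
            m t + L a  ≤⟨ +-monoˡ-≤ (L a) ([b]≤1 (marked ns π S t)) ⟩
            suc (L a)  ≤⟨ s≤s (≤-trans (m≤n+m (L a) (m a)) (L-step a πa<πi)) ⟩
            suc (L i)  ≤⟨ neg ⟩
            U i        ∎
          ... | no _ = begin
            m t + L a  ≤⟨ +-monoʳ-≤ (m t) (≤-trans (m≤n+m (L a) (m a)) (L-step a πa<πt)) ⟩
            m t + L t  ≡⟨ cong (m t +_) Lt≡Ut ⟩
            m t + U t  ≤⟨ U-step t t<i ⟩
            U i        ∎
          unmarked : ¬ T (marked ns π S a) → m t + L a < U a
          unmarked ¬ma with <-cmp (toℕ a) (toℕ i)
          ... | tri< a<i _ _ = ⊥-elim (before-i a<i ha (earlier a a<i ha))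
            where
            ha : T (homogeneous ns π a)
            ha = unmarked⇒homogeneous ¬ma
          ... | tri≈ _ a≡i _ = ⊥-elim (¬ma (subst (T ∘ marked ns π S) (sym (Finₚ.toℕ-injective a≡i)) mi))
          ... | tri> _ _ i<a = ≤-trans (s≤s (after-i i<a)) ([b]+n≤k⇒n<k mi (U-step i i<a))
          by-mark : Dec (T (marked ns π S a)) → m t + L a < U a
          by-mark (yes ma)  = <-≤-trans (+-monoʳ-< (m t) (n<[b]+n ma (L a))) through-t
          by-mark (no  ¬ma) = unmarked ¬ma

      case1-toggleable : ∀ {v} → T (homogeneous ns π (π ⟨$⟩ˡ v))
        → (∀ y → toℕ y < toℕ v → ¬ T (homogeneous ns π (π ⟨$⟩ˡ y)))
        → (∀ j → ¬ T (negativeHomogeneous j))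
        → Toggleable (π ⟨$⟩ˡ v)
      case1-toggleable {v} hv lowest noNegative =
        lowest⇒toggleable (π ⟨$⟩ˡ v) hv lowest′ (λ j → ¬negative⇒nonneg (noNegative j))
        where
        lowest′ : ∀ j → lo j < lo (π ⟨$⟩ˡ v) → ¬ T (homogeneous ns π j)
        lowest′ j πj<v = subst (¬_ ∘ T ∘ homogeneous ns π) (inverseˡ π)
          (lowest (π ⟨$⟩ʳ j) (subst (lo j <_) (cong toℕ (inverseʳ π)) πj<v))

      case2b-toggleable : ∀ {i t} → T (negativeHomogeneous i)
        → (∀ j → toℕ j < toℕ i → ¬ T (negativeHomogeneous j))
        → ¬ T (convertible ns π S i)
        → T (zeroCrossing i t) → (∀ a → toℕ t < toℕ a → ¬ T (zeroCrossing i a))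
        → Toggleable t
      case2b-toggleable {i} {t} negative-i earlier-bool ¬conv zt later =
        lastZero⇒toggleable i t (firstNegative-marked i hi neg earlier ¬conv) neg earlier crossing Lt≡Ut latest
        where
        hi : T (homogeneous ns π i)
        hi = proj₁ (Equivalence.to T-∧ negative-i)
        neg : L i < U i
        neg = Equivalence.to (bdiff≤-1⇔ i) (proj₂ (Equivalence.to T-∧ negative-i))
        earlier : ∀ j → toℕ j < toℕ i → T (homogeneous ns π j) → U j ≤ L j
        earlier j j<i = ¬negative⇒nonneg (earlier-bool j j<i)
        crossing : CrossesFromLeft t i
        crossing = proj₁ (Equivalence.to (zeroCrossing⇔ i t) zt)
        Lt≡Ut : L t ≡ U t
        Lt≡Ut = proj₂ (proj₂ (Equivalence.to (zeroCrossing⇔ i t) zt))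
        latest : ∀ a → toℕ t < toℕ a → CrossesFromLeft a i → T (homogeneous ns π a) → L a ≢ U a
        latest a t<a c ha La≡Ua = later a t<a (Equivalence.from (zeroCrossing⇔ i a) (c , ha , La≡Ua))

  module _ (S : Subset (sum ns)) (t : Fin (sum ns)) where

    private
      S′ : Subset (sum ns)
      S′ = toggle ns π S t
      mt : Bool
      mt = marked ns π S t

    marked-toggle : marked ns π S′ t ≡ not mt
    marked-toggle = lookup∘updateAt t S

    marked-toggle-≢ : ∀ u → u ≢ t → marked ns π S u ≡ marked ns π S′ u
    marked-toggle-≢ u u≢t = sym (lookup∘updateAt′ u t u≢t S)

    U-toggle : ∀ j → U S′ j + [ (toℕ t <ᵇ toℕ j) ∧ mt ] ≡ U S j + [ (toℕ t <ᵇ toℕ j) ∧ not mt ]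
    U-toggle j = subst (λ b → U S′ j + [ (toℕ t <ᵇ toℕ j) ∧ mt ] ≡ U S j + [ (toℕ t <ᵇ toℕ j) ∧ b ])
      marked-toggle (bindAt-update t marked-toggle-≢ (toℕ j))

    L-toggle : ∀ j → L S′ j + [ (lo t <ᵇ lo j) ∧ mt ] ≡ L S j + [ (lo t <ᵇ lo j) ∧ not mt ]
    L-toggle j = subst₂ (λ b c → L S′ j + [ (lo t <ᵇ lo j) ∧ b ] ≡ L S j + [ (lo t <ᵇ lo j) ∧ c ])
      (cong (marked ns π S) (inverseˡ π)) (trans (cong (marked ns π S′) (inverseˡ π)) marked-toggle)
      (bindAt-update (π ⟨$⟩ʳ t) (λ v v≢πt → marked-toggle-≢ (π ⟨$⟩ˡ v) (v≢πt ∘ πˡ≡t⇒)) (lo j))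
      where
      πˡ≡t⇒ : ∀ {v} → π ⟨$⟩ˡ v ≡ t → v ≡ π ⟨$⟩ʳ t
      πˡ≡t⇒ refl = sym (inverseʳ π)

    toggle-preserves-sign : Toggleable S t → ∀ j → (U S′ j ≤ L S′ j ⇔ U S j ≤ L S j)
    toggle-preserves-sign (left , right) j =
      ≤-toggle⇔ mt (toℕ t <ᵇ toℕ j) (lo t <ᵇ lo j) (U-toggle j) (L-toggle j) right′ left′
      where
      right′ : T (toℕ t <ᵇ toℕ j) → ¬ T (lo t <ᵇ lo j) → m S t + L S j < U S j
      right′ t<ᵇj πt≮πj =
        right j (t<j , ≤∧≢⇒< (≮⇒≥ (πt≮πj ∘ <⇒<ᵇ)) (<⇒≢ t<j ∘ cong toℕ ∘ sym ∘ lo-injective))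
        where
        t<j : toℕ t < toℕ j
        t<j = <ᵇ⇒< _ _ t<ᵇj
      left′ : ¬ T (toℕ t <ᵇ toℕ j) → T (lo t <ᵇ lo j) → m S t + U S j ≤ L S j
      left′ t≮j πt<ᵇπj =
        left j (≤∧≢⇒< (≮⇒≥ (t≮j ∘ <⇒<ᵇ)) (<⇒≢ πt<πj ∘ cong lo ∘ sym ∘ Finₚ.toℕ-injective) , πt<πj)
        where
        πt<πj : lo t < lo j
        πt<πj = <ᵇ⇒< _ _ πt<ᵇπj

    toggle-preserves-bwex : Toggleable S t → bwex ns π S′ ≡ bwex ns π S
    toggle-preserves-bwex tg = countF-cong λ j → T-injective
      (⇔.trans (bdiff≥0⇔ S′ j) (⇔.trans (toggle-preserves-sign tg j) (⇔.sym (bdiff≥0⇔ S j))))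

  data ΦStep (S : Subset (sum ns)) : Subset (sum ns) → Set where
    fixes   : ΦStep S S
    toggles : ∀ {t} → Toggleable S t → ΦStep S (toggle ns π S t)

  ΦStep-preserves-bwex : ∀ {S S′} → ΦStep S S′ → bwex ns π S′ ≡ bwex ns π S
  ΦStep-preserves-bwex fixes        = refl
  ΦStep-preserves-bwex {S} (toggles {t} tg) = toggle-preserves-bwex S t tg

  Φ-step : ∀ S → IsMarked ns π S → ΦStep S (ΦS ns π S)
  Φ-step S isMarked with firstF (homogeneous ns π ∘ (π ⟨$⟩ˡ_)) | first (homogeneous ns π ∘ (π ⟨$⟩ˡ_))
  ... | nothing | none _         = fixes
  ... | just v  | some hv lowest with firstF (negativeHomogeneous S) | first (negativeHomogeneous S)
  ...   | nothing | none noNegative = toggles (case1-toggleable S isMarked hv lowest noNegative)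
  ...   | just i  | some negative-i earlier with convertible ns π S i in conv
  ...     | true  = toggles (Equivalence.to (convertible⇔toggleable S i) (Equivalence.from T-≡ conv))
  ...     | false with lastF (zeroCrossing S i) | last (zeroCrossing S i)
  ...       | nothing | none _        = fixes
  ...       | just t  | some zt later = toggles (case2b-toggleable S isMarked negative-i earlier (subst T conv) zt later)

lemma4p6 : (ns : List ℕ) → All (λ n → 0 < n) ns
         → (π : Permutation′ (sum ns)) (S : Subset (sum ns)) → IsMarked ns π S
         → bwexM ns (Φ ns (π , S)) ≡ bwexM ns (π , S)
lemma4p6 ns _ π S isMarked = ΦStep-preserves-bwex ns π (Φ-step ns π S isMarked)
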